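{- Let $n\ge2r$ and $A=\{a_1,\dots,a_r\}\in\binom{[n]}{r}$. There exists $s$ (with $1\le s\le r$) such that $A\prec[s,2s-1]$ if and only if the pair $A,A$ is cross intersecting.
   Context: $[a,b]=\{a,\dots,b\}$, $[n]=[1,n]$; $\binom{[n]}{r}$ is the set of $r$-subsets of $[n]$ listed increasingly. For $A=\{a_1<\dots<a_r\}$ and $C=\{c_1<\dots<c_k\}$, $A\prec C$ means $r\ge k$ and $a_i\le c_i$ for $1\le i\le k$. Compression order: $C\le A$ iff $c_i\le a_i$ for all $i$. Sets $A,B\in\binom{[n]}{r}$ are cross intersecting if $C\cap D\neq\emptyset$ for all $C\le A$, $D\le B$ in $\binom{[n]}{r}$. -}

module Defs where

open import Data.Nat using (ℕ; suc; _+_; _≤_; _<_)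
open import Data.Fin using (Fin; toℕ)
open import Data.Product using (Σ; _×_; ∃₂)
open import Relation.Binary.PropositionalEquality using (_≡_)

-- An element of binom([n], r): an r-subset of [n] = {1,…,n}, listed
-- increasingly as a₀ < a₁ < … < a_{r-1} (0-based indices; the paper's a_i is a (i-1)).
record RSubset (n r : ℕ) : Set where
  constructor mkRSubset
  field
    elem    : Fin r → ℕ
    inRange : ∀ i → 1 ≤ elem i × elem i ≤ n
    incr    : ∀ i j → toℕ i < toℕ j → elem i < elem j
open RSubset public

-- A ≺ [s, 2s-1]: r ≥ s and a_i ≤ c_i = s + i - 1 for 1 ≤ i ≤ s
-- (0-based: a_i ≤ s + i for i < s).
_≺interval_ : ∀ {n r} → RSubset n r → ℕ → Set
_≺interval_ {n} {r} A s =
  s ≤ r × (∀ (i : Fin r) → toℕ i < s → elem A i ≤ s + toℕ i)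

_≤c_ : ∀ {n r} → RSubset n r → RSubset n r → Set
C ≤c A = ∀ i → elem C i ≤ elem A i

Intersect : ∀ {n r} → RSubset n r → RSubset n r → Set
Intersect C D = ∃₂ λ i j → elem C i ≡ elem D j

CrossIntersecting : ∀ {n r} → RSubset n r → RSubset n r → Set
CrossIntersecting {n} {r} A B =
  ∀ (C D : RSubset n r) → C ≤c A → D ≤c B → Intersect C D

-- A ≺ [s, 2s-1] for some s says exactly that a_i ≤ 2i - 1 for some i. If so, any
-- C, D ≤ A have their first i elements in [1, 2i - 1], and 2i elements cannot be
-- placed injectively into 2i - 1 slots without C and D sharing one.
-- Otherwise a_i ≥ 2i for all i, and the odd numbers {1, 3, …, 2r-1} and the even
-- numbers {2, 4, …, 2r} are two disjoint sets below A, which fit in [n] as n ≥ 2r.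
module Submission where

open import Defs
open import Data.Nat using (ℕ; _≤_; _*_)
open import Data.Product using (Σ; _×_)
open import Function.Bundles using (_⇔_)

open import Data.Nat using (suc; _+_; _∸_; _<_; z≤n; s≤s; s≤s⁻¹; _≤?_)
open import Data.Nat.Properties
open import Data.Fin as Fin using (Fin; toℕ; fromℕ<; inject≤; splitAt)
open import Data.Fin.Properties
  using (toℕ-fromℕ<; toℕ-inject≤; toℕ-injective; inject≤-injective; toℕ<n; join-splitAt; pigeonhole; any?)
  renaming (<⇒≢ to <⇒≢ᶠ; <-cmp to <-cmpᶠ)
open import Data.Product using (_,_; proj₁; ∃; ∃₂)
open import Data.Sum using (_⊎_; inj₁; inj₂; [_,_])
open import Data.Empty using (⊥-elim)
open import Function using (_∘_)
open import Function.Bundles using (mk⇔)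
open import Function.Definitions using (Injective)
open import Relation.Nullary using (¬_; yes; no)
open import Relation.Binary using (tri<; tri≈; tri>)
open import Relation.Binary.PropositionalEquality using (_≡_; _≢_; sym; trans; cong; subst)

pigeonhole-common-value : ∀ {k m} (f g : Fin k → Fin m) →
  Injective _≡_ _≡_ f → Injective _≡_ _≡_ g → m < k + k → ∃₂ λ x y → f x ≡ g y
pigeonhole-common-value {k} f g f-inj g-inj m<k+k
  with i , j , i<j , eq ← pigeonhole m<k+k ([ f , g ] ∘ splitAt k) =
  common (splitAt k i) (splitAt k j) (<⇒≢ᶠ i<j ∘ splitAt-injective) eq
  where
  splitAt-injective : splitAt k i ≡ splitAt k j → i ≡ j
  splitAt-injective e =
    trans (sym (join-splitAt k k i)) (trans (cong (Fin.join k k) e) (join-splitAt k k j))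

  common : (u v : Fin k ⊎ Fin k) → u ≢ v → [ f , g ] u ≡ [ f , g ] v → ∃₂ λ x y → f x ≡ g y
  common (inj₁ x) (inj₁ y) u≢v e = ⊥-elim (u≢v (cong inj₁ (f-inj e)))
  common (inj₁ x) (inj₂ y) _   e = x , y , e
  common (inj₂ x) (inj₁ y) _   e = y , x , sym e
  common (inj₂ x) (inj₂ y) u≢v e = ⊥-elim (u≢v (cong inj₂ (g-inj e)))

_∈[1,_] : ℕ → ℕ → Set
v ∈[1, m ] = 1 ≤ v × v ≤ m

toFin : ∀ {v m} → v ∈[1, m ] → Fin m
toFin {v} (1≤v , v≤m) = fromℕ< {v ∸ 1} (≤-trans (≤-reflexive (m+[n∸m]≡n 1≤v)) v≤m)

toFin-injective : ∀ {v w m} (p : v ∈[1, m ]) (q : w ∈[1, m ]) → toFin p ≡ toFin q → v ≡ w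
toFin-injective (1≤v , _) (1≤w , _) e =
  ∸-cancelʳ-≡ 1≤v 1≤w (trans (sym (toℕ-fromℕ< _)) (trans (cong toℕ e) (toℕ-fromℕ< _)))

interval-common-value : ∀ {k m} (f g : Fin k → ℕ) →
  Injective _≡_ _≡_ f → Injective _≡_ _≡_ g →
  (∀ x → f x ∈[1, m ]) → (∀ y → g y ∈[1, m ]) → m < k + k → ∃₂ λ x y → f x ≡ g y
interval-common-value f g f-inj g-inj f∈ g∈ m<k+k
  with x , y , e ← pigeonhole-common-value (toFin ∘ f∈) (toFin ∘ g∈)
                     (f-inj ∘ toFin-injective (f∈ _) (f∈ _))
                     (g-inj ∘ toFin-injective (g∈ _) (g∈ _)) m<k+k =
  x , y , toFin-injective (f∈ x) (g∈ y) e

HasLowElement : ∀ {n r} → RSubset n r → Set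
HasLowElement {r = r} A = ∃ λ (i : Fin r) → elem A i ≤ suc (2 * toℕ i)

module _ {n r : ℕ} (A : RSubset n r) where

  elem-gap : ∀ d (i j : Fin r) → toℕ j ≡ toℕ i + d → elem A i + d ≤ elem A j
  elem-gap 0 i j j≡i+0
    rewrite +-identityʳ (elem A i) | toℕ-injective (trans j≡i+0 (+-identityʳ _)) = ≤-refl
  elem-gap (suc d) i j j≡i+1+d = begin
    elem A i + suc d   ≡⟨ +-suc (elem A i) d ⟩
    suc (elem A i + d) ≤⟨ s≤s (elem-gap d i k (toℕ-fromℕ< i+d<r)) ⟩
    suc (elem A k)     ≤⟨ incr A k j k<j ⟩
    elem A j           ∎
    where
    open ≤-Reasoning
    i+d<j : toℕ i + d < toℕ j
    i+d<j = ≤-reflexive (trans (sym (+-suc (toℕ i) d)) (sym j≡i+1+d))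
    i+d<r : toℕ i + d < r
    i+d<r = <-trans i+d<j (toℕ<n j)
    k : Fin r
    k = fromℕ< i+d<r
    k<j : toℕ k < toℕ j
    k<j = subst (_< toℕ j) (sym (toℕ-fromℕ< i+d<r)) i+d<j

  elem-mono : ∀ {i j} → toℕ i ≤ toℕ j → elem A i ≤ elem A j
  elem-mono {i} {j} i≤j =
    ≤-trans (m≤m+n _ _) (elem-gap (toℕ j ∸ toℕ i) i j (sym (m+[n∸m]≡n i≤j)))

  elem-injective : Injective _≡_ _≡_ (elem A)
  elem-injective {i} {j} e with <-cmpᶠ i j
  ... | tri< i<j _ _ = ⊥-elim (<⇒≢ (incr A i j i<j) e)
  ... | tri≈ _ i≡j _ = i≡j
  ... | tri> _ _ j<i = ⊥-elim (<⇒≢ (incr A j i j<i) (sym e))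

module _ {n r : ℕ} (A : RSubset n r) where

  ≺interval⇒hasLowElement : ∀ {s} → 1 ≤ s → A ≺interval s → HasLowElement A
  ≺interval⇒hasLowElement {suc t} _ (s≤r , below-interval) =
    i , (begin
      elem A i            ≤⟨ below-interval i (subst (_< suc t) (sym i≡t) ≤-refl) ⟩
      suc (t + toℕ i)     ≡⟨ cong (λ u → suc (u + toℕ i)) i≡t ⟨
      suc (toℕ i + toℕ i) ≡⟨ cong (λ u → suc (toℕ i + u)) (+-identityʳ (toℕ i)) ⟨
      suc (2 * toℕ i)     ∎)
    where
    open ≤-Reasoning
    i : Fin r
    i = fromℕ< s≤r
    i≡t : toℕ i ≡ t
    i≡t = toℕ-fromℕ< s≤r

  hasLowElement⇒≺interval : HasLowElement A → Σ ℕ λ s → (1 ≤ s × s ≤ r) × A ≺interval s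
  hasLowElement⇒≺interval (i , aᵢ≤) = suc t , (s≤s z≤n , toℕ<n i) , toℕ<n i , below-interval
    where
    t : ℕ
    t = toℕ i
    below-interval : ∀ j → toℕ j < suc t → elem A j ≤ suc t + toℕ j
    below-interval j j<1+t = +-cancelʳ-≤ d _ _ (begin
      elem A j + d           ≤⟨ elem-gap A d j i (sym j+d≡t) ⟩
      elem A i               ≤⟨ aᵢ≤ ⟩
      suc (t + (t + 0))      ≡⟨ cong (λ u → suc (t + u)) (trans (+-identityʳ t) (sym j+d≡t)) ⟩
      suc (t + (toℕ j + d))  ≡⟨ cong suc (+-assoc t (toℕ j) d) ⟨
      suc t + toℕ j + d      ∎)
      where
      open ≤-Reasoning
      d : ℕ
      d = t ∸ toℕ j
      j+d≡t : toℕ j + d ≡ t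
      j+d≡t = m+[n∸m]≡n (s≤s⁻¹ j<1+t)

  hasLowElement⇒crossIntersecting : HasLowElement A → CrossIntersecting A A
  hasLowElement⇒crossIntersecting (i , aᵢ≤) C D C≤A D≤A =
    let x , y , e = interval-common-value (prefix C) (prefix D)
                      (prefix-injective C) (prefix-injective D)
                      (prefix-∈ C C≤A) (prefix-∈ D D≤A) 1+2t<[1+t]+[1+t]
    in below x , below y , e
    where
    t : ℕ
    t = toℕ i
    below : Fin (suc t) → Fin r
    below x = inject≤ x (toℕ<n i)
    prefix : RSubset n r → Fin (suc t) → ℕ
    prefix C = elem C ∘ below
    prefix-injective : ∀ C → Injective _≡_ _≡_ (prefix C)
    prefix-injective C {x} {y} e = inject≤-injective _ _ x y (elem-injective C e)
    prefix-∈ : ∀ C → C ≤c A → ∀ x → prefix C x ∈[1, suc (2 * t) ]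
    prefix-∈ C C≤A x = proj₁ (inRange C (below x)) ,
      ≤-trans (elem-mono C below-x≤i) (≤-trans (C≤A i) aᵢ≤)
      where
      below-x≤i : toℕ (below x) ≤ t
      below-x≤i = ≤-trans (≤-reflexive (toℕ-inject≤ x _)) (s≤s⁻¹ (toℕ<n x))
    1+2t<[1+t]+[1+t] : suc (2 * t) < suc t + suc t
    1+2t<[1+t]+[1+t] = ≤-reflexive (sym (trans (+-suc (suc t) t)
                                               (cong (λ u → suc (suc (t + u))) (sym (+-identityʳ t)))))

module _ {n r : ℕ} (2r≤n : 2 * r ≤ n) where

  2+2i≤n : ∀ (i : Fin r) → 2 + 2 * toℕ i ≤ n
  2+2i≤n i = ≤-trans (≤-reflexive (sym (*-suc 2 (toℕ i)))) (≤-trans (*-monoʳ-≤ 2 (toℕ<n i)) 2r≤n)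

  odds : RSubset n r
  odds = mkRSubset (λ i → 1 + 2 * toℕ i) (λ i → s≤s z≤n , ≤-trans (n≤1+n _) (2+2i≤n i))
                   (λ i j i<j → s≤s (*-monoʳ-< 2 i<j))

  evens : RSubset n r
  evens = mkRSubset (λ i → 2 + 2 * toℕ i) (λ i → s≤s z≤n , 2+2i≤n i)
                    (λ i j i<j → s≤s (s≤s (*-monoʳ-< 2 i<j)))

  odds-evens-disjoint : ¬ Intersect odds evens
  odds-evens-disjoint (i , j , e) = even≢odd (toℕ i) (toℕ j) (suc-injective e)

  crossIntersecting⇒hasLowElement : (A : RSubset n r) → CrossIntersecting A A → HasLowElement A
  crossIntersecting⇒hasLowElement A cross with any? (λ i → elem A i ≤? suc (2 * toℕ i))
  ... | yes low = low
  ... | no ¬low = ⊥-elim (odds-evens-disjoint (cross odds evens odds≤A evens≤A))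
    where
    evens≤A : evens ≤c A
    evens≤A i = ≰⇒> (¬low ∘ (i ,_))
    odds≤A : odds ≤c A
    odds≤A i = ≤-trans (n≤1+n _) (evens≤A i)

lemma11 : ∀ (n r : ℕ) → 2 * r ≤ n → (A : RSubset n r) →
    (Σ ℕ (λ s → (1 ≤ s × s ≤ r) × A ≺interval s)) ⇔ CrossIntersecting A A
lemma11 n r 2r≤n A = mk⇔
  (λ (_ , (1≤s , _) , A≺[s,2s-1]) →
     hasLowElement⇒crossIntersecting A (≺interval⇒hasLowElement A 1≤s A≺[s,2s-1]))
  (hasLowElement⇒≺interval A ∘ crossIntersecting⇒hasLowElement 2r≤n A)
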